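{- The minion $\mathcal D_\infty=\{(h)\in\mathcal I_1: h\triangleleft h=h^d\}$ is a minion core.
   Context: $\mathcal I_1$ is the set of all idempotent Boolean operations $h:\{0,1\}^n\to\{0,1\}$, $n\in\mathbb N$. For $n$-ary Boolean $f,g$: $f\triangleleft g$ iff $f(\mathbf a)\le g(\mathbf b)$ whenever $\mathbf a\le\mathbf b$ componentwise; $f^d(\mathbf a)=1-f(\overline{\mathbf a})$, $\overline{\mathbf a}$ the coordinatewise negation. $h\triangleleft h=h^d$ means $h\triangleleft h$ and $h=h^d$. $\mathcal D_\infty$ is a minion with $n$-ary part its $n$-ary members and minors $h^{(\alpha)}(a_1,\dots,a_m)=h(a_{\alpha(1)},\dots,a_{\alpha(n)})$. A minion homomorphism is an arity-preserving map commuting with taking minors; a minion core is a minion all of whose self-homomorphisms are invertible (automorphisms). -}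

module Defs where

open import Data.Nat using (ℕ)
open import Data.Fin using (Fin)
open import Data.Bool using (Bool; true; false; not; _≤_)
open import Data.Bool.Properties using (≤-refl)
open import Data.Product using (Σ; _×_; _,_; proj₁; proj₂; ∃)
open import Relation.Binary.PropositionalEquality using (_≡_; refl; cong; trans; sym)
open import Function using (_∘_)

-- n-ary Boolean operations {0,1}^n → {0,1}, with 0 = false, 1 = true
BoolOp : ℕ → Set
BoolOp n = (Fin n → Bool) → Bool

_≤ᵥ_ : ∀ {n} → (Fin n → Bool) → (Fin n → Bool) → Set
a ≤ᵥ b = ∀ i → a i ≤ b i

_◁_ : ∀ {n} → BoolOp n → BoolOp n → Set
f ◁ g = ∀ a b → a ≤ᵥ b → f a ≤ g b

dual : ∀ {n} → BoolOp n → BoolOp n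
dual f a = not (f (not ∘ a))

Idempotent : ∀ {n} → BoolOp n → Set
Idempotent h = ∀ b → h (λ _ → b) ≡ b

-- h ◁ h = h^d  (equality of operations = equality of their values)
InD∞ : ∀ {n} → BoolOp n → Set
InD∞ h = Idempotent h × (h ◁ h) × (∀ a → h a ≡ dual h a)

D∞ : ℕ → Set
D∞ n = Σ (BoolOp n) InD∞

_≈_ : ∀ {n} → D∞ n → D∞ n → Set
f ≈ g = ∀ a → proj₁ f a ≡ proj₁ g a

minorOp : ∀ {n m} → (Fin n → Fin m) → BoolOp n → BoolOp m
minorOp α h a = h (a ∘ α)

minor : ∀ {n m} → (Fin n → Fin m) → D∞ n → D∞ m
minor α (h , idem , mono , sd) =
  minorOp α h , (λ b → idem b) , (λ a b a≤b → mono (a ∘ α) (b ∘ α) (λ i → a≤b (α i))) ,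
  (λ a → sd (a ∘ α))

record Endo : Set where
  field
    map  : ∀ {n} → D∞ n → D∞ n
    cong≈ : ∀ {n} {f g : D∞ n} → f ≈ g → map f ≈ map g

IsMinionHom : Endo → Set
IsMinionHom ξ = ∀ {n m} (α : Fin n → Fin m) (f : D∞ n) →
  Endo.map ξ (minor α f) ≈ minor α (Endo.map ξ f)

IsInvertible : Endo → Set
IsInvertible ξ = Σ Endo λ ψ → IsMinionHom ψ ×
  (∀ {n} (f : D∞ n) → Endo.map ψ (Endo.map ξ f) ≈ f) ×
  (∀ {n} (f : D∞ n) → Endo.map ξ (Endo.map ψ f) ≈ f)

IsMinionCore-D∞ : Set
IsMinionCore-D∞ = (ξ : Endo) → IsMinionHom ξ → IsInvertible ξ

-- Unary D∞ has a single member, the identity, and every binary member is a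
-- projection: idempotence fixes h(0,0) and h(1,1), and self-duality forces
-- h(1,0) = ¬ h(0,1).  A minion homomorphism therefore fixes every binary
-- member, being a minor of the unary one.  An n-ary member f is recovered
-- from its binary minors, since f(a) is the value at (0,1) of the minor of f
-- along i ↦ a(i) ∈ {0,1} ≅ Fin 2.  So every self-homomorphism is the identity.
module Submission where

open import Defs
open import Data.Fin using (Fin; zero; suc)
open import Data.Bool using (Bool; true; false; not)
open import Data.Bool.Properties using (≤-antisym; ≤-reflexive; not-involutive)
open import Data.Product using (_,_; proj₁; proj₂)
open import Function using (_∘_; const)
open import Relation.Binary.PropositionalEquality

apply-cong : ∀ {n} (f : D∞ n) {a b : Fin n → Bool} → (∀ i → a i ≡ b i) →
             proj₁ f a ≡ proj₁ f b
apply-cong (_ , _ , mono , _) {a} {b} a≗b =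
  ≤-antisym (mono a b (≤-reflexive ∘ a≗b)) (mono b a (≤-reflexive ∘ sym ∘ a≗b))

apply-const : ∀ {n} (f : D∞ n) {a : Fin n → Bool} {c : Bool} → (∀ i → a i ≡ c) →
              proj₁ f a ≡ c
apply-const f {c = c} a≗c = trans (apply-cong f a≗c) (proj₁ (proj₂ f) c)

pair : Bool → Bool → Fin 2 → Bool
pair c₀ c₁ zero       = c₀
pair c₀ c₁ (suc zero) = c₁

toBool : Fin 2 → Bool
toBool = pair false true

fromBool : Bool → Fin 2
fromBool false = zero
fromBool true  = suc zero

toBool-fromBool : ∀ b → toBool (fromBool b) ≡ b
toBool-fromBool false = refl
toBool-fromBool true  = refl

pair-const : ∀ c j → pair c c j ≡ c
pair-const c zero       = refl
pair-const c (suc zero) = refl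

pair-tf≗not∘toBool : ∀ j → pair true false j ≡ not (toBool j)
pair-tf≗not∘toBool zero       = refl
pair-tf≗not∘toBool (suc zero) = refl

pair-η : (x : Fin 2 → Bool) → ∀ j → pair (x zero) (x (suc zero)) j ≡ x j
pair-η x zero       = refl
pair-η x (suc zero) = refl

identity₁ : D∞ 1
identity₁ = (λ x → x zero) , (λ _ → refl) , (λ _ _ a≤b → a≤b zero) ,
            (λ a → sym (not-involutive (a zero)))

unary-unique : (f : D∞ 1) → f ≈ identity₁
unary-unique f x = apply-const f λ { zero → refl }

apply-notToBool : (g : D∞ 2) → proj₁ g (not ∘ toBool) ≡ not (proj₁ g toBool)
apply-notToBool g = trans (proj₂ (proj₂ (proj₂ g)) (not ∘ toBool))
                          (cong not (apply-cong g (not-involutive ∘ toBool)))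

binary-pair : (g : D∞ 2) → ∀ c₀ c₁ →
              proj₁ g (pair c₀ c₁) ≡ pair c₀ c₁ (fromBool (proj₁ g toBool))
binary-pair g false false = trans (apply-const g (pair-const false)) (sym (pair-const false _))
binary-pair g true  true  = trans (apply-const g (pair-const true)) (sym (pair-const true _))
binary-pair g false true  = sym (toBool-fromBool _)
binary-pair g true  false = begin
  proj₁ g (pair true false)         ≡⟨ apply-cong g pair-tf≗not∘toBool ⟩
  proj₁ g (not ∘ toBool)            ≡⟨ apply-notToBool g ⟩
  not (proj₁ g toBool)              ≡⟨ cong not (sym (toBool-fromBool _)) ⟩
  not (toBool (fromBool b))         ≡⟨ sym (pair-tf≗not∘toBool (fromBool b)) ⟩
  pair true false (fromBool b)      ∎
  where
    open ≡-Reasoning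
    b : Bool
    b = proj₁ g toBool

binary-isProjection : (g : D∞ 2) → g ≈ minor (const (fromBool (proj₁ g toBool))) identity₁
binary-isProjection g x = begin
  proj₁ g x                     ≡⟨ apply-cong g (sym ∘ pair-η x) ⟩
  proj₁ g (pair x₀ x₁)          ≡⟨ binary-pair g x₀ x₁ ⟩
  pair x₀ x₁ (fromBool b)       ≡⟨ pair-η x (fromBool b) ⟩
  x (fromBool b)                ∎
  where
    open ≡-Reasoning
    x₀ x₁ b : Bool
    x₀ = x zero
    x₁ = x (suc zero)
    b  = proj₁ g toBool

module _ (ξ : Endo) (hom : IsMinionHom ξ) where
  open Endo ξ

  fixes-binary : (g : D∞ 2) → map g ≈ g
  fixes-binary g x = begin
    proj₁ (map g) x                     ≡⟨ cong≈ (binary-isProjection g) x ⟩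
    proj₁ (map (minor β identity₁)) x   ≡⟨ hom β identity₁ x ⟩
    proj₁ (map identity₁) (x ∘ β)       ≡⟨ unary-unique (map identity₁) (x ∘ β) ⟩
    proj₁ (minor β identity₁) x         ≡⟨ sym (binary-isProjection g x) ⟩
    proj₁ g x                           ∎
    where
      open ≡-Reasoning
      β : Fin 1 → Fin 2
      β = const (fromBool (proj₁ g toBool))

  fixes : ∀ {n} (f : D∞ n) → map f ≈ f
  fixes {n} f a = begin
    proj₁ (map f) a                 ≡⟨ apply-cong (map f) (sym ∘ toBool-fromBool ∘ a) ⟩
    proj₁ (minor α (map f)) toBool  ≡⟨ sym (hom α f toBool) ⟩
    proj₁ (map (minor α f)) toBool  ≡⟨ fixes-binary (minor α f) toBool ⟩
    proj₁ (minor α f) toBool        ≡⟨ apply-cong f (toBool-fromBool ∘ a) ⟩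
    proj₁ f a                       ∎
    where
      open ≡-Reasoning
      α : Fin n → Fin 2
      α = fromBool ∘ a

idEndo : Endo
idEndo = record { map = λ f → f ; cong≈ = λ f≈g → f≈g }

idEndo-isMinionHom : IsMinionHom idEndo
idEndo-isMinionHom _ _ _ = refl

lemma4p16 : (ξ : Endo) → IsMinionHom ξ → IsInvertible ξ
lemma4p16 ξ hom = idEndo , idEndo-isMinionHom , fixes ξ hom , fixes ξ hom
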